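{- For every $a\in\Sigma$ and all CSP processes $P,Q$: $(a\to P)\,\Box\,(a\to(P\sqcap Q))\equiv_{CS}^\Delta a\to(P\sqcap Q)$.
   Context: Fix a set $\Sigma$ of communications and an internal action $\tau\notin\Sigma$; $a$ ranges over $\Sigma$ and $\alpha$ over $\Sigma\cup\{\tau\}$. CSP expressions are generated by $P,Q ::= \mathrm{STOP}\mid \mathrm{div}\mid a\to P\mid P\sqcap Q\mid P\,\Box\,Q\mid P\rhd Q\mid P\,\|_A\,Q\mid P\setminus A\mid f(P)\mid P\,\triangle\,Q\mid P\,\Theta_A\,Q\mid X\mid \mu X.P$, with $A\subseteq\Sigma$, $f:\Sigma\to\Sigma$ (extended by $f(\tau)=\tau$), $X$ a process identifier. A CSP process is an expression in which every occurrence of an identifier $X$ lies within a subexpression $\mu X.P$. Transitions $P\xrightarrow{\alpha}P'$ are the least relations such that: $\mathrm{div}\xrightarrow{\tau}\mathrm{div}$; $(a\to P)\xrightarrow{a}P$; $P\sqcap Q\xrightarrow{\tau}P$, $P\sqcap Q\xrightarrow{\tau}Q$; if $P\xrightarrow{a}P'$ then $P\Box Q\xrightarrow{a}P'$, $Q\Box P\xrightarrow{a}P'$, $P\rhd Q\xrightarrow{a}P'$; if $P\xrightarrow{\tau}P'$ then $P\Box Q\xrightarrow{\tau}P'\Box Q$, $Q\Box P\xrightarrow{\tau}Q\Box P'$, $P\rhd Q\xrightarrow{\tau}P'\rhd Q$; $P\rhd Q\xrightarrow{\tau}Q$; if $P\xrightarrow{\alpha}P'$ then $f(P)\xrightarrow{f(\alpha)}f(P')$;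 if $P\xrightarrow{\alpha}P'$, $\alpha\notin A$, then $P\|_AQ\xrightarrow{\alpha}P'\|_AQ$, $Q\|_AP\xrightarrow{\alpha}Q\|_AP'$, $P\setminus A\xrightarrow{\alpha}P'\setminus A$, $P\Theta_AQ\xrightarrow{\alpha}P'\Theta_AQ$; if $P\xrightarrow{a}P'$, $Q\xrightarrow{a}Q'$, $a\in A$, then $P\|_AQ\xrightarrow{a}P'\|_AQ'$; if $P\xrightarrow{a}P'$, $a\in A$, then $P\setminus A\xrightarrow{\tau}P'\setminus A$ and $P\Theta_AQ\xrightarrow{a}Q$; if $P\xrightarrow{\alpha}P'$ then $P\triangle Q\xrightarrow{\alpha}P'\triangle Q$; if $Q\xrightarrow{\tau}Q'$ then $P\triangle Q\xrightarrow{\tau}P\triangle Q'$; if $Q\xrightarrow{a}Q'$ then $P\triangle Q\xrightarrow{a}Q'$; $\mu X.P\xrightarrow{\tau}P[\mu X.P/X]$. Write $P\Rightarrow Q$ if $P=P_0\xrightarrow{\tau}\cdots\xrightarrow{\tau}P_n=Q$ ($n\ge 0$); $P\overset{\alpha}{\Rightarrow}Q$ if $P\Rightarrow P'\xrightarrow{\alpha}Q'\Rightarrow Q$; $P\overset{\hat\alpha}{\Rightarrow}Q$ means $P\overset{\alpha}{\Rightarrow}Q$ if $\alpha\in\Sigma$ and $P\Rightarrow Q$ if $\alpha=\tau$. $P{\Uparrow}$ ($P$ diverges) if there are $P_0,P_1,\dots$ with $P\Rightarrow P_0\xrightarrow{\tau}P_1\xrightarrow{\tau}\cdots$. A coupled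 simulation is a relation $\mathcal R$ on CSP processes such that (i) if $P\mathcal RQ$ and $P\xrightarrow{\alpha}P'$ then $Q\overset{\hat\alpha}{\Rightarrow}Q'$ with $P'\mathcal RQ'$ for some $Q'$, and (ii) if $P\mathcal RQ$ then $Q\Rightarrow Q'$ with $Q'\mathcal RP$ for some $Q'$; it is divergence-preserving if $P\mathcal RQ$ and $P{\Uparrow}$ imply $Q{\Uparrow}$. $P\sqsupseteq_{CS}^\Delta Q$ iff $P\mathcal RQ$ for some divergence-preserving coupled simulation $\mathcal R$; $P\equiv_{CS}^\Delta Q$ iff $P\sqsupseteq_{CS}^\Delta Q$ and $Q\sqsupseteq_{CS}^\Delta P$. -}

module Defs where

open import Level using (Level; 0ℓ) renaming (suc to lsuc)
open import Data.Nat using (ℕ; suc; _≟_)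
open import Data.Product using (Σ-syntax; ∃-syntax; _×_; _,_)
open import Data.Unit using (⊤)
open import Relation.Nullary using (¬_; yes; no)
open import Relation.Binary.PropositionalEquality using (_≡_)

Ident : Set
Ident = ℕ

data Expr (Σ : Set) : Set₁ where
  STOP  : Expr Σ
  div   : Expr Σ
  _⇒ₚ_  : Σ → Expr Σ → Expr Σ
  _⊓_   : Expr Σ → Expr Σ → Expr Σ
  _□_   : Expr Σ → Expr Σ → Expr Σ
  _▷_   : Expr Σ → Expr Σ → Expr Σ
  par   : Expr Σ → (Σ → Set) → Expr Σ → Expr Σ
  hide  : Expr Σ → (Σ → Set) → Expr Σ
  ren   : (Σ → Σ) → Expr Σ → Expr Σ
  _△_   : Expr Σ → Expr Σ → Expr Σ
  throw : Expr Σ → (Σ → Set) → Expr Σ → Expr Σ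
  var   : Ident → Expr Σ
  μ     : Ident → Expr Σ → Expr Σ

data FreeIn {Σ : Set} (X : Ident) : Expr Σ → Set₁ where
  fr-var   : FreeIn X (var X)
  fr-pre   : ∀ {a P} → FreeIn X P → FreeIn X (a ⇒ₚ P)
  fr-⊓ˡ    : ∀ {P Q} → FreeIn X P → FreeIn X (P ⊓ Q)
  fr-⊓ʳ    : ∀ {P Q} → FreeIn X Q → FreeIn X (P ⊓ Q)
  fr-□ˡ    : ∀ {P Q} → FreeIn X P → FreeIn X (P □ Q)
  fr-□ʳ    : ∀ {P Q} → FreeIn X Q → FreeIn X (P □ Q)
  fr-▷ˡ    : ∀ {P Q} → FreeIn X P → FreeIn X (P ▷ Q)
  fr-▷ʳ    : ∀ {P Q} → FreeIn X Q → FreeIn X (P ▷ Q)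
  fr-parˡ  : ∀ {P A Q} → FreeIn X P → FreeIn X (par P A Q)
  fr-parʳ  : ∀ {P A Q} → FreeIn X Q → FreeIn X (par P A Q)
  fr-hide  : ∀ {P A} → FreeIn X P → FreeIn X (hide P A)
  fr-ren   : ∀ {f P} → FreeIn X P → FreeIn X (ren f P)
  fr-△ˡ    : ∀ {P Q} → FreeIn X P → FreeIn X (P △ Q)
  fr-△ʳ    : ∀ {P Q} → FreeIn X Q → FreeIn X (P △ Q)
  fr-thˡ   : ∀ {P A Q} → FreeIn X P → FreeIn X (throw P A Q)
  fr-thʳ   : ∀ {P A Q} → FreeIn X Q → FreeIn X (throw P A Q)
  fr-μ     : ∀ {Y P} → ¬ (X ≡ Y) → FreeIn X P → FreeIn X (μ Y P)

-- a CSP process: every identifier occurrence is bound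
Closed : {Σ : Set} → Expr Σ → Set₁
Closed P = ∀ X → ¬ FreeIn X P

-- substitution P[R/X]; only ever used with closed R, so no capture
_[_/_] : {Σ : Set} → Expr Σ → Expr Σ → Ident → Expr Σ
STOP [ R / X ] = STOP
div [ R / X ] = div
(a ⇒ₚ P) [ R / X ] = a ⇒ₚ (P [ R / X ])
(P ⊓ Q) [ R / X ] = (P [ R / X ]) ⊓ (Q [ R / X ])
(P □ Q) [ R / X ] = (P [ R / X ]) □ (Q [ R / X ])
(P ▷ Q) [ R / X ] = (P [ R / X ]) ▷ (Q [ R / X ])
par P A Q [ R / X ] = par (P [ R / X ]) A (Q [ R / X ])
hide P A [ R / X ] = hide (P [ R / X ]) A
ren f P [ R / X ] = ren f (P [ R / X ])
(P △ Q) [ R / X ] = (P [ R / X ]) △ (Q [ R / X ])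
throw P A Q [ R / X ] = throw (P [ R / X ]) A (Q [ R / X ])
var Y [ R / X ] with Y ≟ X
... | yes _ = R
... | no _ = var Y
μ Y P [ R / X ] with Y ≟ X
... | yes _ = μ Y P
... | no _ = μ Y (P [ R / X ])

data Act (Σ : Set) : Set where
  τ  : Act Σ
  ev : Σ → Act Σ

mapAct : {Σ : Set} → (Σ → Σ) → Act Σ → Act Σ
mapAct f τ = τ
mapAct f (ev a) = ev (f a)

-- α ∉ A  (τ is never in A since τ ∉ Σ)
_∉ₐ_ : {Σ : Set} → Act Σ → (Σ → Set) → Set
τ ∉ₐ A = ⊤
ev a ∉ₐ A = ¬ A a

data _─_⟶_ {Σ : Set} : Expr Σ → Act Σ → Expr Σ → Set₁ where
  div-τ   : div ─ τ ⟶ div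
  pre     : ∀ {a P} → (a ⇒ₚ P) ─ ev a ⟶ P
  ⊓ˡ      : ∀ {P Q} → (P ⊓ Q) ─ τ ⟶ P
  ⊓ʳ      : ∀ {P Q} → (P ⊓ Q) ─ τ ⟶ Q
  □ˡ-a    : ∀ {a P P' Q} → P ─ ev a ⟶ P' → (P □ Q) ─ ev a ⟶ P'
  □ʳ-a    : ∀ {a P P' Q} → P ─ ev a ⟶ P' → (Q □ P) ─ ev a ⟶ P'
  ▷-a     : ∀ {a P P' Q} → P ─ ev a ⟶ P' → (P ▷ Q) ─ ev a ⟶ P'
  □ˡ-τ    : ∀ {P P' Q} → P ─ τ ⟶ P' → (P □ Q) ─ τ ⟶ (P' □ Q)
  □ʳ-τ    : ∀ {P P' Q} → P ─ τ ⟶ P' → (Q □ P) ─ τ ⟶ (Q □ P')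
  ▷-τ     : ∀ {P P' Q} → P ─ τ ⟶ P' → (P ▷ Q) ─ τ ⟶ (P' ▷ Q)
  ▷-slide : ∀ {P Q} → (P ▷ Q) ─ τ ⟶ Q
  ren-α   : ∀ {f α P P'} → P ─ α ⟶ P' → ren f P ─ mapAct f α ⟶ ren f P'
  parˡ    : ∀ {α A P P' Q} → α ∉ₐ A → P ─ α ⟶ P' → par P A Q ─ α ⟶ par P' A Q
  parʳ    : ∀ {α A P P' Q} → α ∉ₐ A → P ─ α ⟶ P' → par Q A P ─ α ⟶ par Q A P'
  hide-α  : ∀ {α A P P'} → α ∉ₐ A → P ─ α ⟶ P' → hide P A ─ α ⟶ hide P' A
  throw-α : ∀ {α A P P' Q} → α ∉ₐ A → P ─ α ⟶ P' → throw P A Q ─ α ⟶ throw P' A Q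
  sync    : ∀ {a A P P' Q Q'} → P ─ ev a ⟶ P' → Q ─ ev a ⟶ Q' → A a →
            par P A Q ─ ev a ⟶ par P' A Q'
  hide-a  : ∀ {a A P P'} → P ─ ev a ⟶ P' → A a → hide P A ─ τ ⟶ hide P' A
  throw-a : ∀ {a A P P' Q} → P ─ ev a ⟶ P' → A a → throw P A Q ─ ev a ⟶ Q
  △ˡ      : ∀ {α P P' Q} → P ─ α ⟶ P' → (P △ Q) ─ α ⟶ (P' △ Q)
  △ʳ-τ    : ∀ {P Q Q'} → Q ─ τ ⟶ Q' → (P △ Q) ─ τ ⟶ (P △ Q')
  △ʳ-a    : ∀ {a P Q Q'} → Q ─ ev a ⟶ Q' → (P △ Q) ─ ev a ⟶ Q'
  unfold  : ∀ {X P} → μ X P ─ τ ⟶ (P [ μ X P / X ])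

data _⟹_ {Σ : Set} : Expr Σ → Expr Σ → Set₁ where
  ε   : ∀ {P} → P ⟹ P
  _◅_ : ∀ {P P' Q} → P ─ τ ⟶ P' → P' ⟹ Q → P ⟹ Q

_=[_]⇒_ : {Σ : Set} → Expr Σ → Act Σ → Expr Σ → Set₁
P =[ α ]⇒ Q = ∃[ P' ] ∃[ Q' ] (P ⟹ P' × P' ─ α ⟶ Q' × Q' ⟹ Q)

_=[_]⇒̂_ : {Σ : Set} → Expr Σ → Act Σ → Expr Σ → Set₁
P =[ τ ]⇒̂ Q = P ⟹ Q
P =[ ev a ]⇒̂ Q = P =[ ev a ]⇒ Q

Diverges : {Σ : Set} → Expr Σ → Set₁
Diverges P = Σ[ s ∈ (ℕ → _) ] (P ⟹ s 0 × (∀ i → s i ─ τ ⟶ s (suc i)))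

record IsDPCoupledSim {Σ : Set} (R : Expr Σ → Expr Σ → Set₁) : Set₁ where
  field
    onProcesses : ∀ {P Q} → R P Q → Closed P × Closed Q
    sim         : ∀ {P Q α P'} → R P Q → P ─ α ⟶ P' →
                  ∃[ Q' ] (Q =[ α ]⇒̂ Q' × R P' Q')
    coupled     : ∀ {P Q} → R P Q → ∃[ Q' ] (Q ⟹ Q' × R Q' P)
    divPres     : ∀ {P Q} → R P Q → Diverges P → Diverges Q

_⊒CSΔ_ : {Σ : Set} → Expr Σ → Expr Σ → Set₂
P ⊒CSΔ Q = ∃[ R ] (IsDPCoupledSim R × R P Q)

_≡CSΔ_ : {Σ : Set} → Expr Σ → Expr Σ → Set₂
P ≡CSΔ Q = (P ⊒CSΔ Q) × (Q ⊒CSΔ P)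

-- If each of two closed processes answers every step of the other by a weak
-- step to the very same process, then the identity on processes together with
-- the pair and its converse is a divergence-preserving coupled simulation.
-- Here the step a → P of the choice is answered by a → (P ⊓ Q) followed by
-- the internal choice of P, and the step a → (P ⊓ Q) of either side is
-- answered by the same step of the other.
module Submission where

open import Defs
open import Data.Nat using (suc; _≟_)
open import Data.Product using (∃-syntax; _×_; _,_)
import Data.Product as Prod
open import Data.Sum using (_⊎_; inj₁; inj₂)
import Data.Sum as Sum
open import Relation.Nullary using (¬_; yes; no)
open import Relation.Binary.PropositionalEquality using (_≡_; sym; trans)

module _ {Σ : Set} where

  Closed-sub : ∀ {P Q : Expr Σ} → (∀ {Y} → FreeIn Y Q → FreeIn Y P) → Closed P → Closed Q
  Closed-sub sub cP Y f = cP Y (sub f)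

  FreeIn-[/] : ∀ {Y X} (P R : Expr Σ) → FreeIn Y (P [ R / X ]) →
               FreeIn Y R ⊎ (¬ Y ≡ X × FreeIn Y P)
  FreeIn-[/] STOP R ()
  FreeIn-[/] div R ()
  FreeIn-[/] (a ⇒ₚ P) R (fr-pre f) = Sum.map₂ (Prod.map₂ fr-pre) (FreeIn-[/] P R f)
  FreeIn-[/] (P ⊓ Q) R (fr-⊓ˡ f) = Sum.map₂ (Prod.map₂ fr-⊓ˡ) (FreeIn-[/] P R f)
  FreeIn-[/] (P ⊓ Q) R (fr-⊓ʳ f) = Sum.map₂ (Prod.map₂ fr-⊓ʳ) (FreeIn-[/] Q R f)
  FreeIn-[/] (P □ Q) R (fr-□ˡ f) = Sum.map₂ (Prod.map₂ fr-□ˡ) (FreeIn-[/] P R f)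
  FreeIn-[/] (P □ Q) R (fr-□ʳ f) = Sum.map₂ (Prod.map₂ fr-□ʳ) (FreeIn-[/] Q R f)
  FreeIn-[/] (P ▷ Q) R (fr-▷ˡ f) = Sum.map₂ (Prod.map₂ fr-▷ˡ) (FreeIn-[/] P R f)
  FreeIn-[/] (P ▷ Q) R (fr-▷ʳ f) = Sum.map₂ (Prod.map₂ fr-▷ʳ) (FreeIn-[/] Q R f)
  FreeIn-[/] (par P A Q) R (fr-parˡ f) = Sum.map₂ (Prod.map₂ fr-parˡ) (FreeIn-[/] P R f)
  FreeIn-[/] (par P A Q) R (fr-parʳ f) = Sum.map₂ (Prod.map₂ fr-parʳ) (FreeIn-[/] Q R f)
  FreeIn-[/] (hide P A) R (fr-hide f) = Sum.map₂ (Prod.map₂ fr-hide) (FreeIn-[/] P R f)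
  FreeIn-[/] (ren g P) R (fr-ren f) = Sum.map₂ (Prod.map₂ fr-ren) (FreeIn-[/] P R f)
  FreeIn-[/] (P △ Q) R (fr-△ˡ f) = Sum.map₂ (Prod.map₂ fr-△ˡ) (FreeIn-[/] P R f)
  FreeIn-[/] (P △ Q) R (fr-△ʳ f) = Sum.map₂ (Prod.map₂ fr-△ʳ) (FreeIn-[/] Q R f)
  FreeIn-[/] (throw P A Q) R (fr-thˡ f) = Sum.map₂ (Prod.map₂ fr-thˡ) (FreeIn-[/] P R f)
  FreeIn-[/] (throw P A Q) R (fr-thʳ f) = Sum.map₂ (Prod.map₂ fr-thʳ) (FreeIn-[/] Q R f)
  FreeIn-[/] {X = X} (var Z) R f with Z ≟ X
  FreeIn-[/] (var Z) R f        | yes _ = inj₁ f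
  FreeIn-[/] (var Z) R fr-var   | no Z≢X = inj₂ (Z≢X , fr-var)
  FreeIn-[/] {X = X} (μ Z P) R f with Z ≟ X
  FreeIn-[/] (μ Z P) R (fr-μ Y≢Z f) | yes Z≡X = inj₂ ((λ Y≡X → Y≢Z (trans Y≡X (sym Z≡X))) , fr-μ Y≢Z f)
  FreeIn-[/] (μ Z P) R (fr-μ Y≢Z f) | no _    = Sum.map₂ (Prod.map₂ (fr-μ Y≢Z)) (FreeIn-[/] P R f)

  Closed-unfold : ∀ {X} {P : Expr Σ} → Closed (μ X P) → Closed (P [ μ X P / X ])
  Closed-unfold {P = P} c Y f with FreeIn-[/] P _ f
  ... | inj₁ g          = c Y g
  ... | inj₂ (Y≢X , g)  = c Y (fr-μ Y≢X g)

  Closed-step : ∀ {P P' : Expr Σ} {α} → Closed P → P ─ α ⟶ P' → Closed P'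
  Closed-step c div-τ = c
  Closed-step c pre = Closed-sub fr-pre c
  Closed-step c ⊓ˡ = Closed-sub fr-⊓ˡ c
  Closed-step c ⊓ʳ = Closed-sub fr-⊓ʳ c
  Closed-step c (□ˡ-a s) = Closed-step (Closed-sub fr-□ˡ c) s
  Closed-step c (□ʳ-a s) = Closed-step (Closed-sub fr-□ʳ c) s
  Closed-step c (▷-a s) = Closed-step (Closed-sub fr-▷ˡ c) s
  Closed-step c (□ˡ-τ s) Y (fr-□ˡ f) = Closed-step (Closed-sub fr-□ˡ c) s Y f
  Closed-step c (□ˡ-τ s) Y (fr-□ʳ f) = c Y (fr-□ʳ f)
  Closed-step c (□ʳ-τ s) Y (fr-□ˡ f) = c Y (fr-□ˡ f)
  Closed-step c (□ʳ-τ s) Y (fr-□ʳ f) = Closed-step (Closed-sub fr-□ʳ c) s Y f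
  Closed-step c (▷-τ s) Y (fr-▷ˡ f) = Closed-step (Closed-sub fr-▷ˡ c) s Y f
  Closed-step c (▷-τ s) Y (fr-▷ʳ f) = c Y (fr-▷ʳ f)
  Closed-step c ▷-slide = Closed-sub fr-▷ʳ c
  Closed-step c (ren-α s) Y (fr-ren f) = Closed-step (Closed-sub fr-ren c) s Y f
  Closed-step c (parˡ _ s) Y (fr-parˡ f) = Closed-step (Closed-sub fr-parˡ c) s Y f
  Closed-step c (parˡ _ s) Y (fr-parʳ f) = c Y (fr-parʳ f)
  Closed-step c (parʳ _ s) Y (fr-parˡ f) = c Y (fr-parˡ f)
  Closed-step c (parʳ _ s) Y (fr-parʳ f) = Closed-step (Closed-sub fr-parʳ c) s Y f
  Closed-step c (hide-α _ s) Y (fr-hide f) = Closed-step (Closed-sub fr-hide c) s Y f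
  Closed-step c (throw-α _ s) Y (fr-thˡ f) = Closed-step (Closed-sub fr-thˡ c) s Y f
  Closed-step c (throw-α _ s) Y (fr-thʳ f) = c Y (fr-thʳ f)
  Closed-step c (sync s _ _) Y (fr-parˡ f) = Closed-step (Closed-sub fr-parˡ c) s Y f
  Closed-step c (sync _ t _) Y (fr-parʳ f) = Closed-step (Closed-sub fr-parʳ c) t Y f
  Closed-step c (hide-a s _) Y (fr-hide f) = Closed-step (Closed-sub fr-hide c) s Y f
  Closed-step c (throw-a _ _) = Closed-sub fr-thʳ c
  Closed-step c (△ˡ s) Y (fr-△ˡ f) = Closed-step (Closed-sub fr-△ˡ c) s Y f
  Closed-step c (△ˡ s) Y (fr-△ʳ f) = c Y (fr-△ʳ f)
  Closed-step c (△ʳ-τ s) Y (fr-△ˡ f) = c Y (fr-△ˡ f)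
  Closed-step c (△ʳ-τ s) Y (fr-△ʳ f) = Closed-step (Closed-sub fr-△ʳ c) s Y f
  Closed-step c (△ʳ-a s) = Closed-step (Closed-sub fr-△ʳ c) s
  Closed-step c unfold = Closed-unfold c

  _◅◅_ : ∀ {P Q R : Expr Σ} → P ⟹ Q → Q ⟹ R → P ⟹ R
  ε ◅◅ t = t
  (s ◅ r) ◅◅ t = s ◅ (r ◅◅ t)

  step⇒weak : ∀ {P P' : Expr Σ} {α} → P ─ α ⟶ P' → P =[ α ]⇒̂ P'
  step⇒weak {α = τ} s = s ◅ ε
  step⇒weak {P} {P'} {ev a} s = P , P' , ε , s , ε

  MatchesStepsOf : Expr Σ → Expr Σ → Set₁
  MatchesStepsOf R L = ∀ {α L'} → L ─ α ⟶ L' → R =[ α ]⇒̂ L'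

  Diverges-transfer : ∀ {L R : Expr Σ} → MatchesStepsOf R L → Diverges L → Diverges R
  Diverges-transfer R≽L (s , ε , steps) = (λ i → s (suc i)) , R≽L (steps 0) , (λ i → steps (suc i))
  Diverges-transfer R≽L (s , first ◅ rest , steps) = s , R≽L first ◅◅ rest , steps

  module _ {L R : Expr Σ} (cL : Closed L) (cR : Closed R)
           (R≽L : MatchesStepsOf R L) (L≽R : MatchesStepsOf L R) where

    data IdWithPair : Expr Σ → Expr Σ → Set₁ where
      pair  : IdWithPair L R
      pair⁻ : IdWithPair R L
      refl  : ∀ {X} → Closed X → IdWithPair X X

    IdWithPair-isDPCoupledSim : IsDPCoupledSim IdWithPair
    IdWithPair-isDPCoupledSim = record
      { onProcesses = onProcesses
      ; sim         = sim
      ; coupled     = coupled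
      ; divPres     = divPres
      }
      where
      onProcesses : ∀ {P Q} → IdWithPair P Q → Closed P × Closed Q
      onProcesses pair     = cL , cR
      onProcesses pair⁻    = cR , cL
      onProcesses (refl c) = c , c

      sim : ∀ {P Q α P'} → IdWithPair P Q → P ─ α ⟶ P' → ∃[ Q' ] (Q =[ α ]⇒̂ Q' × IdWithPair P' Q')
      sim pair     s = _ , R≽L s , refl (Closed-step cL s)
      sim pair⁻    s = _ , L≽R s , refl (Closed-step cR s)
      sim (refl c) s = _ , step⇒weak s , refl (Closed-step c s)

      coupled : ∀ {P Q} → IdWithPair P Q → ∃[ Q' ] (Q ⟹ Q' × IdWithPair Q' P)
      coupled pair     = R , ε , pair⁻
      coupled pair⁻    = L , ε , pair
      coupled (refl c) = _ , ε , refl c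

      divPres : ∀ {P Q} → IdWithPair P Q → Diverges P → Diverges Q
      divPres pair     = Diverges-transfer R≽L
      divPres pair⁻    = Diverges-transfer L≽R
      divPres (refl _) d = d

    mutuallyMatching⇒≡CSΔ : L ≡CSΔ R
    mutuallyMatching⇒≡CSΔ = (IdWithPair , IdWithPair-isDPCoupledSim , pair)
                          , (IdWithPair , IdWithPair-isDPCoupledSim , pair⁻)

proposition25 : {Σ : Set} (a : Σ) (P Q : Expr Σ) → Closed P → Closed Q →
    ((a ⇒ₚ P) □ (a ⇒ₚ (P ⊓ Q))) ≡CSΔ (a ⇒ₚ (P ⊓ Q))
proposition25 a P Q cP cQ = mutuallyMatching⇒≡CSΔ closed-choice closed-prefix prefix≽choice choice≽prefix
  where
  closed-prefix : Closed (a ⇒ₚ (P ⊓ Q))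
  closed-prefix Y (fr-pre (fr-⊓ˡ f)) = cP Y f
  closed-prefix Y (fr-pre (fr-⊓ʳ f)) = cQ Y f

  closed-choice : Closed ((a ⇒ₚ P) □ (a ⇒ₚ (P ⊓ Q)))
  closed-choice Y (fr-□ˡ (fr-pre f)) = cP Y f
  closed-choice Y (fr-□ʳ f)          = closed-prefix Y f

  prefix≽choice : MatchesStepsOf (a ⇒ₚ (P ⊓ Q)) ((a ⇒ₚ P) □ (a ⇒ₚ (P ⊓ Q)))
  prefix≽choice (□ˡ-a pre) = _ , _ , ε , pre , ⊓ˡ ◅ ε
  prefix≽choice (□ʳ-a pre) = _ , _ , ε , pre , ε

  choice≽prefix : MatchesStepsOf ((a ⇒ₚ P) □ (a ⇒ₚ (P ⊓ Q))) (a ⇒ₚ (P ⊓ Q))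
  choice≽prefix pre = _ , _ , ε , □ʳ-a pre , ε
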